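{- Let $(G,p)$ be a walk-independent framework which is reflection-symmetric with reflection $\sigma$, and let $\delta:E_G\to\{\text{red},\text{blue},\text{gold}\}$ be an edge colouring. Then $\delta$ is a Cartesian RS-colouring if and only if all of the following hold: both red and blue occur among the values of $\delta$; every angle-preserving class $r$ with $\sigma r=r$ is gold (all its edges are gold); and for every angle-preserving class $r$ with $\sigma r\neq r$, either all edges of $r$ and of $\sigma r$ are gold, or all edges of one of $r,\sigma r$ are blue and all edges of the other are red.
   Context: Graphs are finite, simple and connected. A reflection of $G=(V_G,E_G)$ is an automorphism $\sigma\neq\mathrm{id}$ with $\sigma^2=\mathrm{id}$; $\sigma e=\sigma(u)\sigma(v)$ and $\sigma r=\{\sigma e:e\in r\}$ for $r\subseteq E_G$. A realisation is a map $p:V_G\to\mathbb{R}^2$ with $p(u)\neq p(v)$ on edges; with $\tau=\begin{bmatrix}-1&0\\0&1\end{bmatrix}$, $(G,p)$ is reflection-symmetric if $p(\sigma v)=\tau p(v)$ for all $v$. Angle-preserving classes: two edges are in relation $\triangle$ if they lie in a common 3-cycle of $G$, and in relation $\square$ if they are opposite edges of a 4-cycle of $G$; the angle-preserving classes are the equivalence classes of the reflexive–transitive closure of $\triangle\cup\square$. For a walk $W=(u_1,\dots,u_k)$ and a class $r$, $\sum_{(u,v)\in r\cap W}(p(v)-p(u))$ denotes $\sum (p(u_{i+1})-p(u_i))$ over all $1\le i<k$ with $u_iu_{i+1}\in r$. $(G,p)$ is walk-independent if $p$ is injective, every induced 4-cycle of $G$ is realised as a parallelogram whose vertices are not all collinear,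 and for every class $r$, all $w_1,w_2\in V_G$ and all walks $W,W'$ from $w_1$ to $w_2$, the sums over $r\cap W$ and $r\cap W'$ coincide. A NAC-colouring is a surjective map $E_G\to\{\text{red},\text{blue}\}$ such that every cycle is monochromatic or has at least two edges of each colour. A pseudo-RS-colouring is a map $\delta:E_G\to\{\text{red},\text{blue},\text{gold}\}$ with: red and blue occur; changing gold to blue gives a NAC-colouring; changing gold to red gives a NAC-colouring; $\delta(e)=\text{red}$ iff $\delta(\sigma e)=\text{blue}$. A cycle is almost red-blue if exactly one edge is gold. An RS-colouring is a pseudo-RS-colouring $\delta$ such that for every almost red-blue cycle $C$ there are edges $e_1,e_2$ of $C$ and a pseudo-RS-colouring $\delta'$ with $\delta(e_1)=\delta(e_2)$, $\delta'(e_1)\neq\delta'(e_2)$. A pseudo-RS-colouring is Cartesian if there do not exist distinct vertices $v,w$ and three paths $P_{rb},P_{rg},P_{bg}$ from $v$ to $w$ such that all edges of $P_{rb}$ are red or blue, all edges of $P_{rg}$ are red or gold, and all edges of $P_{bg}$ are blue or gold. A Cartesian RS-colouring is a Cartesian pseudo-RS-colouring that is an RS-colouring. -}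

module Defs where

open import Data.Nat using (ℕ; zero; suc; _≤_; _∸_)
open import Data.Fin using (Fin)
open import Data.Bool using (Bool; true; false; T; if_then_else_)
open import Data.List using (List; []; _∷_; length)
open import Data.List.Relation.Unary.All using (All)
open import Data.List.Relation.Unary.Unique.Propositional using (Unique)
open import Data.List.Membership.Propositional using (_∈_)
open import Data.Product using (Σ; ∃; ∃-syntax; _×_; _,_; proj₁; proj₂)
open import Data.Sum using (_⊎_; inj₁; inj₂)
open import Relation.Nullary using (¬_)
open import Relation.Binary.PropositionalEquality using (_≡_; _≢_; refl; subst; sym)
open import Relation.Binary.Construct.Closure.ReflexiveTransitive using (Star)
open import Algebra.Structures using (IsCommutativeRing)
open import Relation.Binary.Structures using (IsTotalOrder)
open import Function.Bundles using (_⇔_)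

-- The real numbers, axiomatised as a complete ordered field
-- (this characterises ℝ up to isomorphism).

record RealField : Set₁ where
  infixl 6 _+_
  infixl 7 _*_
  field
    R        : Set
    _+_ _*_  : R → R → R
    -_       : R → R
    0# 1#    : R
    _≤ᴿ_     : R → R → Set
    isCommutativeRing : IsCommutativeRing _≡_ _+_ _*_ -_ 0# 1#
    0≢1      : 0# ≢ 1#
    inverse  : ∀ x → x ≢ 0# → ∃[ y ] (x * y ≡ 1#)
    isTotalOrder : IsTotalOrder _≡_ _≤ᴿ_
    +-mono   : ∀ {x y} z → x ≤ᴿ y → (x + z) ≤ᴿ (y + z)
    *-nonneg : ∀ {x y} → 0# ≤ᴿ x → 0# ≤ᴿ y → 0# ≤ᴿ (x * y)
    complete : (P : R → Set) → ∃ P → (∃[ b ] (∀ x → P x → x ≤ᴿ b)) →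
               ∃[ s ] ((∀ x → P x → x ≤ᴿ s) × (∀ b → (∀ x → P x → x ≤ᴿ b) → s ≤ᴿ b))

module Plane (F : RealField) where
  open RealField F

  Pt : Set
  Pt = R × R

  origin : Pt
  origin = 0# , 0#

  _⊕_ : Pt → Pt → Pt
  (a , b) ⊕ (c , d) = (a + c) , (b + d)

  _⊖_ : Pt → Pt → Pt
  (a , b) ⊖ (c , d) = (a + - c) , (b + - d)

  τ : Pt → Pt
  τ (x , y) = (- x) , y

  cross : Pt → Pt → R
  cross (a , b) (c , d) = a * d + - (b * c)

  Collinear : Pt → Pt → Pt → Set
  Collinear x y z = cross (y ⊖ x) (z ⊖ x) ≡ 0#

  AllCollinear4 : Pt → Pt → Pt → Pt → Set
  AllCollinear4 a b c d =
    Collinear a b c × Collinear a b d × Collinear a c d × Collinear b c d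

record Graph : Set where
  field
    n       : ℕ
    adj     : Fin n → Fin n → Bool
    adj-sym : ∀ u v → adj u v ≡ adj v u
    adj-irr : ∀ v → adj v v ≡ false

data Colour : Set where
  red blue gold : Colour

module _ (G : Graph) where
  open Graph G

  V : Set
  V = Fin n

  Adj : V → V → Set
  Adj u v = T (adj u v)

  data Walk : V → V → Set where
    []  : ∀ {v} → Walk v v
    _∷_ : ∀ {u w v} → Adj u w → Walk w v → Walk u v

  Connected : Set
  Connected = ∀ u v → Walk u v

  -- (oriented) edges; an unordered edge uv is represented by both (u,v) and (v,u)
  record Edge : Set where
    constructor edge
    field
      src tgt : V
      isAdj   : Adj src tgt
  open Edge public

  rev : Edge → Edge
  rev (edge u v a) = edge v u (subst T (adj-sym u v) a)

  OnEdge : Edge → V → V → Set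
  OnEdge e a b = (src e ≡ a × tgt e ≡ b) ⊎ (src e ≡ b × tgt e ≡ a)

  edges : ∀ {u v} → Walk u v → List Edge
  edges [] = []
  edges (_∷_ {u} {w} a W) = edge u w a ∷ edges W

  verts : ∀ {u v} → Walk u v → List V
  verts ([] {v}) = v ∷ []
  verts (_∷_ {u} a W) = u ∷ verts W

  inner : ∀ {u v} → Walk u v → List V
  inner [] = []
  inner (_∷_ {u} a W) = u ∷ inner W

  IsPath : ∀ {u v} → Walk u v → Set
  IsPath W = Unique (verts W)

  IsCycle : ∀ {v} → Walk v v → Set
  IsCycle W = Unique (inner W) × 3 ≤ length (inner W)

  Tri : Edge → Edge → Set
  Tri e e' = Σ V λ a → Σ V λ b → Σ V λ c →
    Adj a b × Adj b c × Adj c a ×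
    (OnEdge e a b ⊎ OnEdge e b c ⊎ OnEdge e c a) ×
    (OnEdge e' a b ⊎ OnEdge e' b c ⊎ OnEdge e' c a)

  Sq : Edge → Edge → Set
  Sq e e' = Σ V λ a → Σ V λ b → Σ V λ c → Σ V λ d →
    Adj a b × Adj b c × Adj c d × Adj d a × a ≢ c × b ≢ d ×
    ((OnEdge e a b × OnEdge e' c d) ⊎ (OnEdge e c d × OnEdge e' a b) ⊎
     (OnEdge e b c × OnEdge e' d a) ⊎ (OnEdge e d a × OnEdge e' b c))

  APStep : Edge → Edge → Set
  APStep e e' = OnEdge e' (src e) (tgt e) ⊎ Tri e e' ⊎ Sq e e'

  -- e' lies in the angle-preserving class of e
  AP : Edge → Edge → Set
  AP = Star APStep

  _≐_ : Edge → Edge → Set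
  e ≐ e' = src e ≡ src e' × tgt e ≡ tgt e'

  record Reflection : Set where
    field
      σ       : V → V
      σ-adj   : ∀ u v → adj (σ u) (σ v) ≡ adj u v
      σ-invol : ∀ v → σ (σ v) ≡ v
      σ-nonid : ∃[ v ] (σ v ≢ v)

  σE : Reflection → Edge → Edge
  σE s (edge u v a) = edge (σ u) (σ v) (subst T (sym (σ-adj u v)) a)
    where open Reflection s

  -- σ r = r, where r is the class of e
  ClassFixed : Reflection → Edge → Set
  ClassFixed s e =
    (∀ e' → AP e e' → AP e (σE s e')) ×
    (∀ e' → AP e e' → ∃[ e'' ] (AP e e'' × σE s e'' ≐ e'))

  record Colouring : Set where
    field
      col     : Edge → Colour
      col-sym : ∀ e → col (rev e) ≡ col e
  open Colouring public

  count : (Edge → Bool) → List Edge → ℕ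
  count c [] = 0
  count c (e ∷ es) = if c e then suc (count c es) else count c es

  isCol : Colour → Colour → Bool
  isCol red red = true
  isCol blue blue = true
  isCol gold gold = true
  isCol _ _ = false

  -- NAC-colouring; true = red, false = blue
  IsNAC : (Edge → Bool) → Set
  IsNAC c =
    (∃[ e ] (c e ≡ true)) × (∃[ e ] (c e ≡ false)) ×
    (∀ v (C : Walk v v) → IsCycle C →
       let k = length (edges C) ; r = count c (edges C) in
       r ≡ 0 ⊎ r ≡ k ⊎ (2 ≤ r × 2 ≤ k ∸ r))

  goldToBlue : Colour → Bool
  goldToBlue red = true
  goldToBlue blue = false
  goldToBlue gold = false

  goldToRed : Colour → Bool
  goldToRed red = true
  goldToRed blue = false
  goldToRed gold = true

  PseudoRS : Reflection → Colouring → Set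
  PseudoRS s δ =
    (∃[ e ] (col δ e ≡ red)) × (∃[ e ] (col δ e ≡ blue)) ×
    IsNAC (λ e → goldToBlue (col δ e)) ×
    IsNAC (λ e → goldToRed (col δ e)) ×
    (∀ e → (col δ e ≡ red) ⇔ (col δ (σE s e) ≡ blue))

  IsRS : Reflection → Colouring → Set
  IsRS s δ =
    PseudoRS s δ ×
    (∀ v (C : Walk v v) → IsCycle C → count (λ e → isCol gold (col δ e)) (edges C) ≡ 1 →
      Σ Edge λ e₁ → Σ Edge λ e₂ → e₁ ∈ edges C × e₂ ∈ edges C ×
      Σ Colouring λ δ' → PseudoRS s δ' × col δ e₁ ≡ col δ e₂ × col δ' e₁ ≢ col δ' e₂)

  IsCartesian : Colouring → Set
  IsCartesian δ = ¬ (Σ V λ v → Σ V λ w → v ≢ w ×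
    Σ (Walk v w) λ Prb → Σ (Walk v w) λ Prg → Σ (Walk v w) λ Pbg →
    IsPath Prb × IsPath Prg × IsPath Pbg ×
    All (λ e → col δ e ≡ red ⊎ col δ e ≡ blue) (edges Prb) ×
    All (λ e → col δ e ≡ red ⊎ col δ e ≡ gold) (edges Prg) ×
    All (λ e → col δ e ≡ blue ⊎ col δ e ≡ gold) (edges Pbg))

  IsCartesianRS : Reflection → Colouring → Set
  IsCartesianRS s δ = IsRS s δ × IsCartesian δ

  RedBlueOccur : Colouring → Set
  RedBlueOccur δ = (∃[ e ] (col δ e ≡ red)) × (∃[ e ] (col δ e ≡ blue))

  FixedClassesGold : Reflection → Colouring → Set
  FixedClassesGold s δ = ∀ e → ClassFixed s e → ∀ e' → AP e e' → col δ e' ≡ gold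

  -- for r the class of e, "all edges of σ r" = all σ e' with e' ∈ r
  NonFixedClassesOK : Reflection → Colouring → Set
  NonFixedClassesOK s δ = ∀ e → ¬ ClassFixed s e →
    (∀ e' → AP e e' → col δ e' ≡ gold × col δ (σE s e') ≡ gold) ⊎
    (∀ e' → AP e e' → col δ e' ≡ blue × col δ (σE s e') ≡ red) ⊎
    (∀ e' → AP e e' → col δ e' ≡ red × col δ (σE s e') ≡ blue)

module Framework (F : RealField) (G : Graph) where
  open RealField F
  open Plane F

  Realisation : (V G → Pt) → Set
  Realisation p = ∀ (e : Edge G) → p (src e) ≢ p (tgt e)

  ReflectionSymmetric : Reflection G → (V G → Pt) → Set
  ReflectionSymmetric s p = ∀ v → p (Reflection.σ s v) ≡ τ (p v)

  wsum : (V G → Pt) → (Edge G → Bool) → ∀ {u v} → Walk G u v → Pt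
  wsum p d [] = origin
  wsum p d (_∷_ {u} {w} a W) =
    (if d (edge u w a) then p w ⊖ p u else origin) ⊕ wsum p d W

  InducedSquare : V G → V G → V G → V G → Set
  InducedSquare a b c d =
    Adj G a b × Adj G b c × Adj G c d × Adj G d a × a ≢ c × b ≢ d ×
    ¬ Adj G a c × ¬ Adj G b d

  WalkIndependent : (V G → Pt) → Set
  WalkIndependent p =
    (∀ u v → p u ≡ p v → u ≡ v) ×
    (∀ a b c d → InducedSquare a b c d →
       (p b ⊖ p a ≡ p c ⊖ p d) × ¬ AllCollinear4 (p a) (p b) (p c) (p d)) ×
    (∀ (e : Edge G) (d : Edge G → Bool) → (∀ e' → T (d e') ⇔ AP G e e') →
       ∀ w₁ w₂ (W W' : Walk G w₁ w₂) → wsum p d W ≡ wsum p d W')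

-- A Cartesian pseudo-RS-colouring is constant on angle-preserving classes. Both NAC-colourings obtained by
-- recolouring gold force a 3-cycle to be monochromatic and a 4-cycle either to have equal opposite edges or to
-- consist of two monochromatic 2-paths between opposite corners; in the latter case Cartesianness makes the two
-- colours equal. As σ swaps red and blue, a class with σ r = r is then gold, and the three conditions follow.
--
-- Conversely, the conditions make δ constant on classes, with σ swapping red and blue. Walk-independence of
-- the class sums extends to unions of classes, so around a cycle the sum over any union of classes vanishes:
-- no cycle has exactly one edge in such a union, since that edge would have length 0. This yields both NAC
-- conditions and makes the RS condition vacuous. For Cartesianness, split p w − p v along the red/blue path into
-- its red part, equal to that along the blue/gold path, and its blue part, equal to that along the red/gold
-- path; both vanish, so p v = p w and v = w.

module Submission where

open import Defs
open import Data.Product using (_×_)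
open import Function.Bundles using (_⇔_)

open import Algebra.Bundles using (CommutativeRing)
import Algebra.Properties.AbelianGroup as AbelianGroupProperties
import Algebra.Properties.CommutativeSemigroup as CommutativeSemigroupProperties
open import Data.Bool using (Bool; true; false; T; if_then_else_; _∧_; not)
open import Data.Bool.Properties using (T-irrelevant; T-∧; T-not-≡)
open import Data.Empty using (⊥-elim)
open import Data.Fin using (Fin; zero; suc; _≟_)
import Data.Fin.Properties as Fin
open import Data.List using (List; []; _∷_; _++_; length)
open import Data.List.Membership.Propositional using (_∈_; find)
open import Data.List.Relation.Unary.All as All using (All; []; _∷_)
open import Data.List.Relation.Unary.All.Properties as All using (¬Any⇒All¬)
open import Data.List.Relation.Unary.AllPairs using ([]; _∷_)
open import Data.List.Relation.Unary.Any as Any using (here; there)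
open import Data.Nat as ℕ using (ℕ; zero; suc; _≤_; _<_; _∸_)
import Data.Nat.Properties as ℕ
open import Data.Product as Product using (Σ; ∃; _,_; proj₁; proj₂)
open import Data.Sum using (_⊎_; inj₁; inj₂; [_,_])
open import Data.Unit.Polymorphic using (⊤)
open import Function.Base using (id; _∘_)
open import Function.Bundles using (_↪_; mk⇔; module Equivalence; module RightInverse)
open import Function.Properties.Inverse using (↔-sym; ↔⇒↪)
open import Level using (Level; 0ℓ)
open import Relation.Binary.Core using (Rel; _Preserves_⟶_)
open import Relation.Binary.Definitions using (Decidable; DecidableEquality)
open import Relation.Binary.PropositionalEquality
  using (_≡_; _≢_; refl; sym; trans; cong; cong₂; subst; subst₂; module ≡-Reasoning)
open import Relation.Binary.Construct.Closure.ReflexiveTransitive as Star using (Star; ε; _◅_; _◅◅_; gmap)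
open import Relation.Nullary using (¬_; Dec; yes; no; ¬?)
open import Relation.Nullary.Decidable
  using (map′; _×-dec_; _⊎-dec_; _→-dec_; T?; from-yes; isYes; isYes≗does; does-⇔; toWitness; fromWitness)

open ≡-Reasoning

private
  variable
    ℓ ℓ′ : Level
    A : Set ℓ

-- Reachability in finite relations

-- Star R on Fin (suc m) is Star on Fin m of the relation allowing single detours through the removed vertex 0.
module EliminateZero {m : ℕ} (R : Rel (Fin (suc m)) ℓ) where

  Detour : Rel (Fin m) ℓ
  Detour i j = R (suc i) (suc j) ⊎ (R (suc i) zero × R zero (suc j))

  Reach : Rel (Fin (suc m)) ℓ
  Reach (suc i) (suc j) = Star Detour i j
  Reach (suc i) zero    = ∃ λ k → Star Detour i k × R (suc k) zero
  Reach zero    (suc j) = ∃ λ k → R zero (suc k) × Star Detour k j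
  Reach zero    zero    = ⊤

  Reach-step : ∀ {x y z} → R x y → Reach y z → Reach x z
  Reach-step {suc i} {suc k} {suc j} r ds             = inj₁ r ◅ ds
  Reach-step {suc i} {suc k} {zero}  r (k′ , ds , r′) = k′ , inj₁ r ◅ ds , r′
  Reach-step {suc i} {zero}  {suc j} r (k , r′ , ds)  = inj₂ (r , r′) ◅ ds
  Reach-step {suc i} {zero}  {zero}  r _              = i , ε , r
  Reach-step {zero}  {suc k} {suc j} r ds             = k , r , ds
  Reach-step {zero}  {suc k} {zero}  r _              = _
  Reach-step {zero}  {zero}          r reach          = reach

  Star⇒Reach : ∀ {x y} → Star R x y → Reach x y
  Star⇒Reach {suc i} ε = ε
  Star⇒Reach {zero}  ε = _
  Star⇒Reach (r ◅ rs)  = Reach-step r (Star⇒Reach rs)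

  Detours⇒Star : ∀ {i j} → Star Detour i j → Star R (suc i) (suc j)
  Detours⇒Star ε                    = ε
  Detours⇒Star (inj₁ r ◅ ds)        = r ◅ Detours⇒Star ds
  Detours⇒Star (inj₂ (r , r′) ◅ ds) = r ◅ r′ ◅ Detours⇒Star ds

  Reach⇒Star : ∀ {x y} → Reach x y → Star R x y
  Reach⇒Star {suc i} {suc j} ds           = Detours⇒Star ds
  Reach⇒Star {suc i} {zero}  (k , ds , r) = Detours⇒Star ds ◅◅ (r ◅ ε)
  Reach⇒Star {zero}  {suc j} (k , r , ds) = r ◅ Detours⇒Star ds
  Reach⇒Star {zero}  {zero}  _            = ε

Star-dec-Fin : ∀ m {R : Rel (Fin m) ℓ} → Decidable R → Decidable (Star R)
Star-dec-Fin (suc m) {R} R? x y = map′ Reach⇒Star Star⇒Reach (Reach? x y)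
  where
  open EliminateZero R

  Detour? : Decidable Detour
  Detour? i j = R? (suc i) (suc j) ⊎-dec (R? (suc i) zero ×-dec R? zero (suc j))

  Reach? : Decidable Reach
  Reach? (suc i) (suc j) = Star-dec-Fin m Detour? i j
  Reach? (suc i) zero    = Fin.any? λ k → Star-dec-Fin m Detour? i k ×-dec R? (suc k) zero
  Reach? zero    (suc j) = Fin.any? λ k → R? zero (suc k) ×-dec Star-dec-Fin m Detour? k j
  Reach? zero    zero    = yes _

Star-dec-↪ : ∀ {m} {R : Rel A ℓ′} → A ↪ Fin m → Decidable R → Decidable (Star R)
Star-dec-↪ {R = R} A↪Fin R? a b =
  map′ (subst₂ (Star R) (from∘to a) (from∘to b) ∘ gmap from id)
       (gmap to λ {x} {y} → subst₂ R (sym (from∘to x)) (sym (from∘to y)))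
       (Star-dec-Fin _ (λ i j → R? (from i) (from j)) (to a) (to b))
  where
  open RightInverse A↪Fin renaming (strictlyInverseʳ to from∘to)

-- Colours

_≟ᶜ_ : DecidableEquality Colour
red  ≟ᶜ red  = yes refl
blue ≟ᶜ blue = yes refl
gold ≟ᶜ gold = yes refl
red  ≟ᶜ blue = no λ ()
red  ≟ᶜ gold = no λ ()
blue ≟ᶜ red  = no λ ()
blue ≟ᶜ gold = no λ ()
gold ≟ᶜ red  = no λ ()
gold ≟ᶜ blue = no λ ()

∀ᶜ? : {P : Colour → Set} → (∀ c → Dec (P c)) → Dec (∀ c → P c)
∀ᶜ? P? = map′ (λ (r , b , g) → λ { red → r ; blue → b ; gold → g })
              (λ f → f red , f blue , f gold)
              (P? red ×-dec P? blue ×-dec P? gold)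

≢gold⇒red⊎blue : ∀ {c} → c ≢ gold → c ≡ red ⊎ c ≡ blue
≢gold⇒red⊎blue {red}  _      = inj₁ refl
≢gold⇒red⊎blue {blue} _      = inj₂ refl
≢gold⇒red⊎blue {gold} c≢gold = ⊥-elim (c≢gold refl)

≢blue⇒red⊎gold : ∀ {c} → c ≢ blue → c ≡ red ⊎ c ≡ gold
≢blue⇒red⊎gold {red}  _      = inj₁ refl
≢blue⇒red⊎gold {blue} c≢blue = ⊥-elim (c≢blue refl)
≢blue⇒red⊎gold {gold} _      = inj₂ refl

≢red⇒blue⊎gold : ∀ {c} → c ≢ red → c ≡ blue ⊎ c ≡ gold
≢red⇒blue⊎gold {red}  c≢red = ⊥-elim (c≢red refl)
≢red⇒blue⊎gold {blue} _     = inj₁ refl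
≢red⇒blue⊎gold {gold} _     = inj₂ refl

swapRB : Colour → Colour
swapRB red  = blue
swapRB blue = red
swapRB gold = gold

swapRB-fixed : ∀ {c} → swapRB c ≡ c → c ≡ gold
swapRB-fixed {red}  ()
swapRB-fixed {blue} ()
swapRB-fixed {gold} _ = refl

swapRB-transpose : ∀ {c d} → swapRB c ≡ d → c ≡ swapRB d
swapRB-transpose {red}  refl = refl
swapRB-transpose {blue} refl = refl
swapRB-transpose {gold} refl = refl

-- Graphs and angle-preserving classes

module GraphProperties (G : Graph) where
  open Graph G

  private
    variable
      u v a b c d : V G
      e e′ : Edge G

  Adj-irrefl : Adj G u v → u ≢ v
  Adj-irrefl {u} uv refl = subst T (adj-irr u) uv

  Adj-sym : Adj G u v → Adj G v u
  Adj-sym {u} {v} = subst T (adj-sym u v)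

  edge-irrelevant : (x y : Adj G u v) → edge {G} u v x ≡ edge u v y
  edge-irrelevant {u} {v} x y = cong (edge u v) (T-irrelevant x y)

  edge-≡ : src e ≡ src e′ → tgt e ≡ tgt e′ → e ≡ e′
  edge-≡ {edge u v x} {edge .u .v y} refl refl = edge-irrelevant x y

  σE-involutive : (s : Reflection G) → ∀ e → σE G s (σE G s e) ≡ e
  σE-involutive s e = edge-≡ (σ-invol (src e)) (σ-invol (tgt e))
    where open Reflection s

  col-OnEdge : (δ : Colouring G) → OnEdge G e a b → (ab : Adj G a b) → col δ e ≡ col δ (edge a b ab)
  col-OnEdge δ (inj₁ (refl , refl)) ab = cong (col δ) (edge-≡ refl refl)
  col-OnEdge δ (inj₂ (refl , refl)) ab = trans (cong (col δ) (edge-≡ refl refl)) (col-sym δ (edge _ _ ab))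

  col-OnEdges : (δ : Colouring G) → OnEdge G e a b → (ab : Adj G a b) → OnEdge G e′ c d → (cd : Adj G c d) →
    col δ (edge a b ab) ≡ col δ (edge c d cd) → col δ e ≡ col δ e′
  col-OnEdges δ e-ab ab e′-cd cd eq = trans (col-OnEdge δ e-ab ab) (trans eq (sym (col-OnEdge δ e′-cd cd)))

  OnEdge-sym : OnEdge G e (src e′) (tgt e′) → OnEdge G e′ (src e) (tgt e)
  OnEdge-sym (inj₁ (p , q)) = inj₁ (sym p , sym q)
  OnEdge-sym (inj₂ (p , q)) = inj₂ (sym q , sym p)

  private
    swap-opposite : ∀ {A₁ B₁ A₂ B₂ A₃ B₃ A₄ B₄ : Set} →
      (A₁ × B₁) ⊎ (A₂ × B₂) ⊎ (A₃ × B₃) ⊎ (A₄ × B₄) → (B₂ × A₂) ⊎ (B₁ × A₁) ⊎ (B₄ × A₄) ⊎ (B₃ × A₃)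
    swap-opposite (inj₁ (x , y))               = inj₂ (inj₁ (y , x))
    swap-opposite (inj₂ (inj₁ (x , y)))        = inj₁ (y , x)
    swap-opposite (inj₂ (inj₂ (inj₁ (x , y)))) = inj₂ (inj₂ (inj₂ (y , x)))
    swap-opposite (inj₂ (inj₂ (inj₂ (x , y)))) = inj₂ (inj₂ (inj₁ (y , x)))

  APStep-sym : APStep G e e′ → APStep G e′ e
  APStep-sym {e} {e′} (inj₁ same) = inj₁ (OnEdge-sym {e′} {e} same)
  APStep-sym (inj₂ (inj₁ (a , b , c , ab , bc , ca , side , side′))) =
    inj₂ (inj₁ (a , b , c , ab , bc , ca , side′ , side))
  APStep-sym (inj₂ (inj₂ (a , b , c , d , ab , bc , cd , da , a≢c , b≢d , sides))) =
    inj₂ (inj₂ (a , b , c , d , ab , bc , cd , da , a≢c , b≢d , swap-opposite sides))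

  AP-sym : AP G e e′ → AP G e′ e
  AP-sym = Star.reverse (λ {e} {e′} → APStep-sym {e} {e′})

  OnEdge? : ∀ e a b → Dec (OnEdge G e a b)
  OnEdge? e a b = (src e ≟ a ×-dec tgt e ≟ b) ⊎-dec (src e ≟ b ×-dec tgt e ≟ a)

  Tri? : ∀ e e′ → Dec (Tri G e e′)
  Tri? e e′ = Fin.any? λ a → Fin.any? λ b → Fin.any? λ c →
    T? (adj a b) ×-dec T? (adj b c) ×-dec T? (adj c a) ×-dec sides? e a b c ×-dec sides? e′ a b c
    where
    sides? : ∀ e a b c → Dec (OnEdge G e a b ⊎ OnEdge G e b c ⊎ OnEdge G e c a)
    sides? e a b c = OnEdge? e a b ⊎-dec OnEdge? e b c ⊎-dec OnEdge? e c a

  Sq? : ∀ e e′ → Dec (Sq G e e′)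
  Sq? e e′ = Fin.any? λ a → Fin.any? λ b → Fin.any? λ c → Fin.any? λ d →
    T? (adj a b) ×-dec T? (adj b c) ×-dec T? (adj c d) ×-dec T? (adj d a) ×-dec
    ¬? (a ≟ c) ×-dec ¬? (b ≟ d) ×-dec
    ((OnEdge? e a b ×-dec OnEdge? e′ c d) ⊎-dec (OnEdge? e c d ×-dec OnEdge? e′ a b) ⊎-dec
     (OnEdge? e b c ×-dec OnEdge? e′ d a) ⊎-dec (OnEdge? e d a ×-dec OnEdge? e′ b c))

  APStep? : ∀ e e′ → Dec (APStep G e e′)
  APStep? e e′ = OnEdge? e′ (src e) (tgt e) ⊎-dec Tri? e e′ ⊎-dec Sq? e e′

  -- Edges carry adjacency proofs, so AP is decided on the finite type of vertex pairs instead.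
  private
    PairStep : Rel (V G × V G) 0ℓ
    PairStep (u , v) (u′ , v′) =
      Σ (Adj G u v) λ uv → Σ (Adj G u′ v′) λ u′v′ → APStep G (edge u v uv) (edge u′ v′ u′v′)

    PairStep? : Decidable PairStep
    PairStep? (u , v) (u′ , v′) with T? (adj u v) | T? (adj u′ v′)
    ... | yes uv | yes u′v′ =
      map′ (λ step → uv , u′v′ , step)
           (λ (x , y , step) → subst₂ (APStep G) (edge-irrelevant x uv) (edge-irrelevant y u′v′) step)
           (APStep? (edge u v uv) (edge u′ v′ u′v′))
    ... | no ¬uv | _        = no λ (uv , _) → ¬uv uv
    ... | yes _  | no ¬u′v′ = no λ (_ , u′v′ , _) → ¬u′v′ u′v′

    ends : Edge G → V G × V G
    ends e = src e , tgt e

    Pairs⇒AP : ∀ {x y} → Star PairStep x y → (xx : Adj G (proj₁ x) (proj₂ x)) (yy : Adj G (proj₁ y) (proj₂ y)) →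
               AP G (edge _ _ xx) (edge _ _ yy)
    Pairs⇒AP ε xx yy = subst (AP G (edge _ _ xx)) (edge-irrelevant xx yy) ε
    Pairs⇒AP ((xx′ , zz , step) ◅ steps) xx yy =
      subst (λ e → APStep G e (edge _ _ zz)) (edge-irrelevant xx′ xx) step ◅ Pairs⇒AP steps zz yy

  AP? : Decidable (AP G)
  AP? e e′ = map′ (λ steps → Pairs⇒AP steps (isAdj e) (isAdj e′))
                  (gmap ends λ {e} {e′} step → isAdj e , isAdj e′ , step)
                  (Star-dec-↪ (↔⇒↪ (↔-sym Fin.*↔×)) PairStep? (ends e) (ends e′))

-- Colourings of short cycles

NACCount : ℕ → ℕ → Set
NACCount k r = r ≡ 0 ⊎ r ≡ k ⊎ (2 ≤ r × 2 ≤ k ∸ r)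

NACCount? : ∀ k r → Dec (NACCount k r)
NACCount? k r = r ℕ.≟ 0 ⊎-dec r ℕ.≟ k ⊎-dec (2 ℕ.≤? r ×-dec 2 ℕ.≤? k ∸ r)

NACCount-complement : ∀ {r q k} → r ℕ.+ q ≡ k → r ≢ 1 → q ≢ 1 → NACCount k r
NACCount-complement {zero}                      _    _   _   = inj₁ refl
NACCount-complement {suc zero}                  _    r≢1 _   = ⊥-elim (r≢1 refl)
NACCount-complement {suc (suc r)} {zero}        refl _   _   = inj₂ (inj₁ (sym (ℕ.+-identityʳ _)))
NACCount-complement {suc (suc r)} {suc zero}    _    _   q≢1 = ⊥-elim (q≢1 refl)
NACCount-complement {suc (suc r)} {suc (suc q)} refl _   _   =
  inj₂ (inj₂ (ℕ.s≤s (ℕ.s≤s ℕ.z≤n) , subst (2 ≤_) (sym (ℕ.m+n∸m≡n (2 ℕ.+ r) (2 ℕ.+ q))) (ℕ.s≤s (ℕ.s≤s ℕ.z≤n))))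

-- Mirrors count, so that for an explicit cycle C the count G (f ∘ col δ) (edges G C) in IsNAC is
-- definitionally countᶜ f applied to the colours of C.
countᶜ : (Colour → Bool) → List Colour → ℕ
countᶜ f []       = 0
countᶜ f (c ∷ cs) = if f c then suc (countᶜ f cs) else countᶜ f cs

-- Both lemmas are decided by evaluation on all 27, respectively 81, colourings.
module _ (G : Graph) where

  triangle-colours : ∀ x y z →
    NACCount 3 (countᶜ (goldToBlue G) (x ∷ y ∷ z ∷ [])) →
    NACCount 3 (countᶜ (goldToRed G) (x ∷ y ∷ z ∷ [])) →
    x ≡ y × y ≡ z
  triangle-colours = from-yes (∀ᶜ? λ x → ∀ᶜ? λ y → ∀ᶜ? λ z →
    NACCount? 3 (countᶜ (goldToBlue G) (x ∷ y ∷ z ∷ [])) →-dec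
    NACCount? 3 (countᶜ (goldToRed G) (x ∷ y ∷ z ∷ [])) →-dec
    (x ≟ᶜ y ×-dec y ≟ᶜ z))

  square-colours : ∀ x y z w →
    NACCount 4 (countᶜ (goldToBlue G) (x ∷ y ∷ z ∷ w ∷ [])) →
    NACCount 4 (countᶜ (goldToRed G) (x ∷ y ∷ z ∷ w ∷ [])) →
    (x ≡ z × y ≡ w) ⊎ (x ≡ y × z ≡ w) ⊎ (y ≡ z × w ≡ x)
  square-colours = from-yes (∀ᶜ? λ x → ∀ᶜ? λ y → ∀ᶜ? λ z → ∀ᶜ? λ w →
    NACCount? 4 (countᶜ (goldToBlue G) (x ∷ y ∷ z ∷ w ∷ [])) →-dec
    NACCount? 4 (countᶜ (goldToRed G) (x ∷ y ∷ z ∷ w ∷ [])) →-dec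
    ((x ≟ᶜ z ×-dec y ≟ᶜ w) ⊎-dec (x ≟ᶜ y ×-dec z ≟ᶜ w) ⊎-dec (y ≟ᶜ z ×-dec w ≟ᶜ x)))

-- Cartesian pseudo-RS-colourings are constant on classes

module _ {G : Graph} (δ : Colouring G) where
  open GraphProperties G

  private
    variable
      a b c d v w : V G
      e e′ : Edge G
      α β : Colour

  -- If α ≢ β, every pair of colours contains α or β, so P and Q supply all three paths forbidden by IsCartesian.
  cartesian-monochromatic : IsCartesian G δ → v ≢ w → (P Q : Walk G v w) → IsPath G P → IsPath G Q →
    All (λ e → col δ e ≡ α) (edges G P) → All (λ e → col δ e ≡ β) (edges G Q) → α ≡ β
  cartesian-monochromatic {v = v} {w} {α} {β} cartesian v≢w P Q P-path Q-path P-α Q-β with α ≟ᶜ β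
  ... | yes α≡β = α≡β
  ... | no α≢β =
    let Prb , Prb-path , Prb-col = pathAvoiding gold ≢gold⇒red⊎blue
        Prg , Prg-path , Prg-col = pathAvoiding blue ≢blue⇒red⊎gold
        Pbg , Pbg-path , Pbg-col = pathAvoiding red ≢red⇒blue⊎gold
    in ⊥-elim (cartesian (v , w , v≢w , Prb , Prg , Pbg ,
                          Prb-path , Prg-path , Pbg-path , Prb-col , Prg-col , Pbg-col))
    where
    pathAvoiding : ∀ γ {C : Colour → Set} → (∀ {c} → c ≢ γ → C c) →
                   Σ (Walk G v w) λ W → IsPath G W × All (λ e → C (col δ e)) (edges G W)
    pathAvoiding γ {C} C-of with α ≟ᶜ γ
    ... | no α≢γ   = P , P-path , All.map (λ e≡α → subst C (sym e≡α) (C-of α≢γ)) P-α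
    ... | yes refl = Q , Q-path , All.map (λ e≡β → subst C (sym e≡β) (C-of (α≢β ∘ sym))) Q-β

  square-halves : IsCartesian G δ → (ab : Adj G a b) (bc : Adj G b c) (cd : Adj G c d) (da : Adj G d a) → a ≢ c →
    col δ (edge a b ab) ≡ col δ (edge b c bc) → col δ (edge c d cd) ≡ col δ (edge d a da) →
    col δ (edge a b ab) ≡ col δ (edge d a da)
  square-halves cartesian ab bc cd da a≢c ab≡bc cd≡da =
    cartesian-monochromatic cartesian a≢c (ab ∷ bc ∷ []) (Adj-sym da ∷ Adj-sym cd ∷ [])
      (path₂ ab bc a≢c) (path₂ (Adj-sym da) (Adj-sym cd) a≢c)
      (refl ∷ sym ab≡bc ∷ []) (col-sym δ _ ∷ trans (col-sym δ _) cd≡da ∷ [])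
    where
    path₂ : (ab : Adj G a b) (bc : Adj G b c) → a ≢ c → IsPath G (ab ∷ bc ∷ [])
    path₂ ab bc a≢c = (Adj-irrefl ab ∷ a≢c ∷ []) ∷ (Adj-irrefl bc ∷ []) ∷ [] ∷ []

  module _ (nac-blue : IsNAC G (λ e → goldToBlue G (col δ e)))
           (nac-red : IsNAC G (λ e → goldToRed G (col δ e))) where

    triangle-monochromatic : (ab : Adj G a b) (bc : Adj G b c) (ca : Adj G c a) →
      col δ (edge a b ab) ≡ col δ (edge b c bc) × col δ (edge b c bc) ≡ col δ (edge c a ca)
    triangle-monochromatic {a} ab bc ca =
      triangle-colours G _ _ _ (proj₂ (proj₂ nac-blue) a C C-cycle) (proj₂ (proj₂ nac-red) a C C-cycle)
      where
      C : Walk G a a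
      C = ab ∷ bc ∷ ca ∷ []

      C-cycle : IsCycle G C
      C-cycle = ((Adj-irrefl ab ∷ Adj-irrefl ca ∘ sym ∷ []) ∷ (Adj-irrefl bc ∷ []) ∷ [] ∷ [])
              , ℕ.s≤s (ℕ.s≤s (ℕ.s≤s ℕ.z≤n))

    square-opposite : IsCartesian G δ → (ab : Adj G a b) (bc : Adj G b c) (cd : Adj G c d) (da : Adj G d a) →
      a ≢ c → b ≢ d → col δ (edge a b ab) ≡ col δ (edge c d cd) × col δ (edge b c bc) ≡ col δ (edge d a da)
    square-opposite {a} cartesian ab bc cd da a≢c b≢d
      with square-colours G _ _ _ _ (proj₂ (proj₂ nac-blue) a C C-cycle) (proj₂ (proj₂ nac-red) a C C-cycle)
      where
      C : Walk G a a
      C = ab ∷ bc ∷ cd ∷ da ∷ []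

      C-cycle : IsCycle G C
      C-cycle = ((Adj-irrefl ab ∷ a≢c ∷ Adj-irrefl da ∘ sym ∷ []) ∷ (Adj-irrefl bc ∷ b≢d ∷ []) ∷ (Adj-irrefl cd ∷ [])
                 ∷ [] ∷ [])
              , ℕ.s≤s (ℕ.s≤s (ℕ.s≤s ℕ.z≤n))
    ... | inj₁ opposite = opposite
    ... | inj₂ (inj₁ (x≡y , z≡w)) =
      let x≡w = square-halves cartesian ab bc cd da a≢c x≡y z≡w in trans x≡w (sym z≡w) , trans (sym x≡y) x≡w
    ... | inj₂ (inj₂ (y≡z , w≡x)) =
      let y≡x = square-halves cartesian bc cd da ab b≢d y≡z w≡x in trans (sym y≡x) y≡z , trans y≡x (sym w≡x)

    Tri-col : Tri G e e′ → col δ e ≡ col δ e′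
    Tri-col (a , b , c , ab , bc , ca , side , side′) with triangle-monochromatic ab bc ca
    ... | ab≡bc , bc≡ca = trans (on-side side) (sym (on-side side′))
      where
      on-side : ∀ {f} → OnEdge G f a b ⊎ OnEdge G f b c ⊎ OnEdge G f c a → col δ f ≡ col δ (edge a b ab)
      on-side (inj₁ f-ab)        = col-OnEdge δ f-ab ab
      on-side (inj₂ (inj₁ f-bc)) = trans (col-OnEdge δ f-bc bc) (sym ab≡bc)
      on-side (inj₂ (inj₂ f-ca)) = trans (col-OnEdge δ f-ca ca) (sym (trans ab≡bc bc≡ca))

    Sq-col : IsCartesian G δ → Sq G e e′ → col δ e ≡ col δ e′
    Sq-col cartesian (a , b , c , d , ab , bc , cd , da , a≢c , b≢d , sides)
      with square-opposite cartesian ab bc cd da a≢c b≢d | sides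
    ... | ab≡cd , _     | inj₁ (e-ab , e′-cd)               = col-OnEdges δ e-ab ab e′-cd cd ab≡cd
    ... | ab≡cd , _     | inj₂ (inj₁ (e-cd , e′-ab))        = col-OnEdges δ e-cd cd e′-ab ab (sym ab≡cd)
    ... | _     , bc≡da | inj₂ (inj₂ (inj₁ (e-bc , e′-da))) = col-OnEdges δ e-bc bc e′-da da bc≡da
    ... | _     , bc≡da | inj₂ (inj₂ (inj₂ (e-da , e′-bc))) = col-OnEdges δ e-da da e′-bc bc (sym bc≡da)

    cartesian⇒classConstant : IsCartesian G δ → col δ Preserves AP G ⟶ _≡_
    cartesian⇒classConstant cartesian ε              = refl
    cartesian⇒classConstant cartesian (step ◅ steps) =
      trans (APStep-col step) (cartesian⇒classConstant cartesian steps)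
      where
      APStep-col : APStep G e e′ → col δ e ≡ col δ e′
      APStep-col {e} (inj₁ same)        = sym (col-OnEdge δ same (isAdj e))
      APStep-col (inj₂ (inj₁ triangle)) = Tri-col triangle
      APStep-col (inj₂ (inj₂ square))   = Sq-col cartesian square

-- Colours of classes under the reflection

module _ {G : Graph} (s : Reflection G) (δ : Colouring G) where
  open GraphProperties G

  private
    variable
      e : Edge G

  SwapsRedBlue : Set
  SwapsRedBlue = ∀ e → col δ (σE G s e) ≡ swapRB (col δ e)

  nonGold-swaps⇒swapsRedBlue : (∀ e → col δ e ≢ gold → col δ (σE G s e) ≡ swapRB (col δ e)) → SwapsRedBlue
  nonGold-swaps⇒swapsRedBlue nonGold-swaps e with col δ e ≟ᶜ gold | col δ (σE G s e) ≟ᶜ gold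
  ... | no e≢gold  | _           = nonGold-swaps e e≢gold
  ... | yes e-gold | yes σe-gold = trans σe-gold (cong swapRB (sym e-gold))
  ... | yes e-gold | no σe≢gold  = ⊥-elim (σe≢gold (swapRB-transpose (begin
    swapRB (col δ (σE G s e))  ≡⟨ nonGold-swaps (σE G s e) σe≢gold ⟨
    col δ (σE G s (σE G s e))  ≡⟨ cong (col δ) (σE-involutive s e) ⟩
    col δ e                    ≡⟨ e-gold ⟩
    gold                       ∎)))

  red⇔σblue⇒swapsRedBlue : (∀ e → (col δ e ≡ red) ⇔ (col δ (σE G s e) ≡ blue)) → SwapsRedBlue
  red⇔σblue⇒swapsRedBlue red⇔σblue = nonGold-swaps⇒swapsRedBlue nonGold-swaps
    where
    nonGold-swaps : ∀ e → col δ e ≢ gold → col δ (σE G s e) ≡ swapRB (col δ e)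
    nonGold-swaps e e≢gold with col δ e in e-col
    ... | red  = Equivalence.to (red⇔σblue e) e-col
    ... | blue = Equivalence.from (red⇔σblue (σE G s e)) (trans (cong (col δ) (σE-involutive s e)) e-col)
    ... | gold = ⊥-elim (e≢gold refl)

  swapsRedBlue⇒red⇔σblue : SwapsRedBlue → ∀ e → (col δ e ≡ red) ⇔ (col δ (σE G s e) ≡ blue)
  swapsRedBlue⇒red⇔σblue swaps e = mk⇔
    (λ e-red → trans (swaps e) (cong swapRB e-red))
    (λ σe-blue → swapRB-transpose (trans (sym (swaps e)) σe-blue))

  UniformClass : Edge G → Colour → Set
  UniformClass e c = ∀ e′ → AP G e e′ → col δ e′ ≡ c × col δ (σE G s e′) ≡ swapRB c

  uniformClass-self : ∀ {c} → UniformClass e c → UniformClass e (col δ e)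
  uniformClass-self {e} uniform = subst (UniformClass e) (sym (proj₁ (uniform e ε))) uniform

  -- The codomain is NonFixedClassesOK G s δ e, once swapRB is unfolded.
  uniformClass-cases : ∀ {c} → UniformClass e c → UniformClass e gold ⊎ UniformClass e blue ⊎ UniformClass e red
  uniformClass-cases {c = red}  uniform = inj₂ (inj₂ uniform)
  uniformClass-cases {c = blue} uniform = inj₂ (inj₁ uniform)
  uniformClass-cases {c = gold} uniform = inj₁ uniform

  module _ (constant : col δ Preserves AP G ⟶ _≡_) (swaps : SwapsRedBlue) where

    classConstant⇒uniformClass : ∀ e → UniformClass e (col δ e)
    classConstant⇒uniformClass e e′ e~e′ =
      sym (constant e~e′) , trans (swaps e′) (cong swapRB (sym (constant e~e′)))

    classConstant⇒fixedClassesGold : FixedClassesGold G s δ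
    classConstant⇒fixedClassesGold e (σ-closed , _) e′ e~e′ = swapRB-fixed (begin
      swapRB (col δ e′)  ≡⟨ swaps e′ ⟨
      col δ (σE G s e′)  ≡⟨ constant (σ-closed e′ e~e′) ⟨
      col δ e            ≡⟨ constant e~e′ ⟩
      col δ e′           ∎)

    classConstant⇒nonFixedClassesOK : NonFixedClassesOK G s δ
    classConstant⇒nonFixedClassesOK e _ = uniformClass-cases (classConstant⇒uniformClass e)

  module _ (fixedGold : FixedClassesGold G s δ) (nonFixedOK : NonFixedClassesOK G s δ) where

    nonGold⇒uniformClass : col δ e ≢ gold → UniformClass e (col δ e)
    nonGold⇒uniformClass {e} e≢gold =
      [ uniformClass-self , [ uniformClass-self , uniformClass-self ] ]
        (nonFixedOK e λ fixed → e≢gold (fixedGold e fixed e ε))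

    conditions⇒classConstant : col δ Preserves AP G ⟶ _≡_
    conditions⇒classConstant {e} {e′} e~e′ with col δ e ≟ᶜ gold | col δ e′ ≟ᶜ gold
    ... | no e≢gold  | _           = sym (proj₁ (nonGold⇒uniformClass e≢gold e′ e~e′))
    ... | yes _      | no e′≢gold  = proj₁ (nonGold⇒uniformClass e′≢gold e (AP-sym e~e′))
    ... | yes e-gold | yes e′-gold = trans e-gold (sym e′-gold)

    conditions⇒swapsRedBlue : SwapsRedBlue
    conditions⇒swapsRedBlue = nonGold-swaps⇒swapsRedBlue λ e e≢gold → proj₂ (nonGold⇒uniformClass e≢gold e ε)

-- Walk sums

module _ {G : Graph} where

  private
    variable
      c : Edge G → Bool
      e₀ : Edge G
      es : List (Edge G)

  count≡0⇒none : ∀ es → count G c es ≡ 0 → All (λ e → ¬ T (c e)) es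
  count≡0⇒none [] _ = []
  count≡0⇒none {c} (e ∷ es) none with c e in ce
  count≡0⇒none (e ∷ es) ()   | true
  count≡0⇒none (e ∷ es) none | false = subst T ce ∷ count≡0⇒none es none

  count-complement : ∀ (c : Edge G → Bool) es → count G c es ℕ.+ count G (λ e → not (c e)) es ≡ length es
  count-complement c [] = refl
  count-complement c (e ∷ es) with c e
  ... | true  = cong suc (count-complement c es)
  ... | false = trans (ℕ.+-suc _ _) (cong suc (count-complement c es))

  count-∧-≤ : ∀ (c b : Edge G → Bool) es → count G (λ e → c e ∧ b e) es ≤ count G c es
  count-∧-≤ c b [] = ℕ.z≤n
  count-∧-≤ c b (e ∷ es) with c e | b e
  ... | true  | true  = ℕ.s≤s (count-∧-≤ c b es)
  ... | true  | false = ℕ.m≤n⇒m≤1+n (count-∧-≤ c b es)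
  ... | false | _     = count-∧-≤ c b es

  count-∧-< : ∀ (c b : Edge G → Bool) → e₀ ∈ es → T (c e₀) → ¬ T (b e₀) →
    count G (λ e → c e ∧ b e) es < count G c es
  count-∧-< c b (here {x = e₀} {xs = es} refl) ce₀ ¬be₀ with c e₀ | b e₀
  ... | true  | false = ℕ.s≤s (count-∧-≤ c b es)
  ... | true  | true  = ⊥-elim (¬be₀ _)
  ... | false | _     = ⊥-elim ce₀
  count-∧-< c b (there {x = e} e₀∈) ce₀ ¬be₀ with c e | b e
  ... | true  | true  = ℕ.s≤s (count-∧-< c b e₀∈ ce₀ ¬be₀)
  ... | true  | false = ℕ.m<n⇒m<1+n (count-∧-< c b e₀∈ ce₀ ¬be₀)
  ... | false | _     = count-∧-< c b e₀∈ ce₀ ¬be₀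

module PlaneProperties (F : RealField) where
  open RealField F using (isCommutativeRing)
  open Plane F

  private
    ring : CommutativeRing 0ℓ 0ℓ
    ring = record { isCommutativeRing = isCommutativeRing }

  open CommutativeRing ring
    using (_+_; -_; 0#; +-identityˡ; +-identityʳ; -‿inverseˡ; -‿inverseʳ; +-comm; +-assoc;
           +-abelianGroup; +-commutativeSemigroup)
  open AbelianGroupProperties +-abelianGroup using (x∙y⁻¹≈ε⇒x≈y)
  open CommutativeSemigroupProperties +-commutativeSemigroup using (interchange)

  ⊕-identityˡ : ∀ x → origin ⊕ x ≡ x
  ⊕-identityˡ (a , b) = cong₂ _,_ (+-identityˡ a) (+-identityˡ b)

  ⊕-identityʳ : ∀ x → x ⊕ origin ≡ x
  ⊕-identityʳ (a , b) = cong₂ _,_ (+-identityʳ a) (+-identityʳ b)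

  ⊕-interchange : ∀ x y z t → (x ⊕ y) ⊕ (z ⊕ t) ≡ (x ⊕ z) ⊕ (y ⊕ t)
  ⊕-interchange (a , a′) (b , b′) (c , c′) (d , d′) = cong₂ _,_ (interchange a b c d) (interchange a′ b′ c′ d′)

  ⊖-self : ∀ x → x ⊖ x ≡ origin
  ⊖-self (a , b) = cong₂ _,_ (-‿inverseʳ a) (-‿inverseʳ b)

  ⊖≡origin⇒≡ : ∀ x y → x ⊖ y ≡ origin → x ≡ y
  ⊖≡origin⇒≡ (a , a′) (b , b′) eq = cong₂ _,_ (x∙y⁻¹≈ε⇒x≈y a b (cong proj₁ eq)) (x∙y⁻¹≈ε⇒x≈y a′ b′ (cong proj₂ eq))

  ⊖-telescope : ∀ x y z → (y ⊖ x) ⊕ (z ⊖ y) ≡ z ⊖ x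
  ⊖-telescope (a , a′) (b , b′) (c , c′) = cong₂ _,_ (telescope a b c) (telescope a′ b′ c′)
    where
    telescope : ∀ a b c → (b + - a) + (c + - b) ≡ c + - a
    telescope a b c = begin
      (b + - a) + (c + - b)  ≡⟨ +-comm (b + - a) (c + - b) ⟩
      (c + - b) + (b + - a)  ≡⟨ +-assoc c (- b) (b + - a) ⟩
      c + (- b + (b + - a))  ≡⟨ cong (c +_) (+-assoc (- b) b (- a)) ⟨
      c + ((- b + b) + - a)  ≡⟨ cong (λ t → c + (t + - a)) (-‿inverseˡ b) ⟩
      c + (0# + - a)         ≡⟨ cong (c +_) (+-identityˡ (- a)) ⟩
      c + - a                ∎

module WalkSums (F : RealField) {G : Graph} (p : V G → Plane.Pt F) where
  open Plane F
  open PlaneProperties F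
  open Framework F G using (wsum)
  open GraphProperties G

  private
    variable
      u v : V G
      c c′ : Edge G → Bool

  wsum-none : (W : Walk G u v) → All (λ e → ¬ T (c e)) (edges G W) → wsum p c W ≡ origin
  wsum-none [] [] = refl
  wsum-none {c = c} (_∷_ {u} {w} uw W) (¬ce ∷ none) with c (edge u w uw)
  ... | true  = ⊥-elim (¬ce _)
  ... | false = trans (⊕-identityˡ _) (wsum-none W none)

  wsum-cong : (W : Walk G u v) → All (λ e → c e ≡ c′ e) (edges G W) → wsum p c W ≡ wsum p c′ W
  wsum-cong [] [] = refl
  wsum-cong (_∷_ {u} {w} uw W) (eq ∷ eqs) =
    cong₂ _⊕_ (cong (λ b → if b then p w ⊖ p u else origin) eq) (wsum-cong W eqs)

  wsum-split : ∀ (c d : Edge G → Bool) (W : Walk G u v) →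
    wsum p c W ≡ wsum p (λ e → c e ∧ d e) W ⊕ wsum p (λ e → c e ∧ not (d e)) W
  wsum-split c d [] = sym (⊕-identityˡ origin)
  wsum-split c d (_∷_ {u} {w} uw W) =
    trans (cong₂ _⊕_ (step-split (c (edge u w uw)) (d (edge u w uw))) (wsum-split c d W)) (⊕-interchange _ _ _ _)
    where
    step : Bool → Pt
    step b = if b then p w ⊖ p u else origin

    step-split : ∀ b b′ → step b ≡ step (b ∧ b′) ⊕ step (b ∧ not b′)
    step-split true  true  = sym (⊕-identityʳ _)
    step-split true  false = sym (⊕-identityˡ _)
    step-split false _     = sym (⊕-identityˡ origin)

  wsum-all : (W : Walk G u v) → wsum p (λ _ → true) W ≡ p v ⊖ p u
  wsum-all [] = sym (⊖-self _)
  wsum-all (_∷_ {u} {w} {v} uw W) = trans (cong ((p w ⊖ p u) ⊕_) (wsum-all W)) (⊖-telescope (p u) (p w) (p v))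

  wsum-count≡1 : (W : Walk G u v) → count G c (edges G W) ≡ 1 →
    Σ (Edge G) λ e → wsum p c W ≡ p (tgt e) ⊖ p (src e)
  wsum-count≡1 {c = c} (_∷_ {u} {w} uw W) one with c (edge u w uw)
  ... | true  = edge u w uw ,
    trans (cong ((p w ⊖ p u) ⊕_) (wsum-none W (count≡0⇒none _ (ℕ.suc-injective one)))) (⊕-identityʳ _)
  ... | false = Product.map₂ (trans (⊕-identityˡ _)) (wsum-count≡1 W one)

  module _ (class-independent : ∀ (e : Edge G) (d : Edge G → Bool) → (∀ e′ → T (d e′) ⇔ AP G e e′) →
                                ∀ w₁ w₂ (W W′ : Walk G w₁ w₂) → wsum p d W ≡ wsum p d W′) where

    private
      inClass : Edge G → Edge G → Bool
      inClass e₀ e = isYes (AP? e₀ e)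

      ¬outsideClass-self : ∀ e₀ → ¬ T (not (inClass e₀ e₀))
      ¬outsideClass-self e₀ outside = subst T (Equivalence.to T-not-≡ outside) (fromWitness {a? = AP? e₀ e₀} ε)

      restrict-class : c Preserves AP G ⟶ _≡_ → ∀ {e₀} → T (c e₀) → ∀ e → T (c e ∧ inClass e₀ e) ⇔ AP G e₀ e
      restrict-class {c} constant {e₀} ce₀ e = mk⇔
        (λ t → toWitness {a? = AP? e₀ e} (proj₂ (Equivalence.to T-∧ t)))
        (λ e₀~e → Equivalence.from (T-∧ {c e}) (subst T (constant e₀~e) ce₀ , fromWitness {a? = AP? e₀ e} e₀~e))

      remove-class-constant : c Preserves AP G ⟶ _≡_ → ∀ e₀ → (λ e → c e ∧ not (inClass e₀ e)) Preserves AP G ⟶ _≡_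
      remove-class-constant constant e₀ {e} {e′} e~e′ =
        cong₂ (λ b b′ → b ∧ not b′) (constant e~e′)
              (isYes-⇔ (mk⇔ (_◅◅ e~e′) (_◅◅ AP-sym e~e′)) (AP? e₀ e) (AP? e₀ e′))
        where
        isYes-⇔ : ∀ {A B : Set} → A ⇔ B → (a? : Dec A) (b? : Dec B) → isYes a? ≡ isYes b?
        isYes-⇔ A⇔B a? b? = trans (isYes≗does a?) (trans (does-⇔ A⇔B a? b?) (sym (isYes≗does b?)))

      -- Split off the class of a c-edge of W or W′: walk-independence handles it, and fewer c-edges remain.
      wsum-indep-bounded : ∀ n c → c Preserves AP G ⟶ _≡_ → (W W′ : Walk G u v) →
        count G c (edges G W ++ edges G W′) < n → wsum p c W ≡ wsum p c W′
      wsum-indep-bounded (suc n) c constant W W′ bound with Any.any? (λ e → T? (c e)) (edges G W ++ edges G W′)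
      ... | no none =
        let noneW , noneW′ = All.++⁻ (edges G W) (¬Any⇒All¬ _ none)
        in trans (wsum-none W noneW) (sym (wsum-none W′ noneW′))
      ... | yes some with find some
      ...   | e₀ , e₀∈ , ce₀ = begin
        wsum p c W                                            ≡⟨ wsum-split c (inClass e₀) W ⟩
        wsum p (λ e → c e ∧ inClass e₀ e) W ⊕ wsum p rest W
          ≡⟨ cong₂ _⊕_ (class-independent e₀ _ (restrict-class constant ce₀) _ _ W W′)
                       (wsum-indep-bounded n rest (remove-class-constant constant e₀) W W′ rest-bound) ⟩
        wsum p (λ e → c e ∧ inClass e₀ e) W′ ⊕ wsum p rest W′ ≡⟨ wsum-split c (inClass e₀) W′ ⟨
        wsum p c W′                                           ∎
        where
        rest : Edge G → Bool
        rest e = c e ∧ not (inClass e₀ e)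

        rest-bound : count G rest (edges G W ++ edges G W′) < n
        rest-bound = ℕ.<-≤-trans (count-∧-< c (not ∘ inClass e₀) e₀∈ ce₀ (¬outsideClass-self e₀)) (ℕ.≤-pred bound)

    classConstant⇒wsum-indep : c Preserves AP G ⟶ _≡_ → (W W′ : Walk G u v) → wsum p c W ≡ wsum p c W′
    classConstant⇒wsum-indep {c} constant W W′ = wsum-indep-bounded _ c constant W W′ ℕ.≤-refl

    module _ (realisation : Framework.Realisation F G p) where

      classConstant⇒count≢1 : c Preserves AP G ⟶ _≡_ → (C : Walk G v v) → count G c (edges G C) ≢ 1
      classConstant⇒count≢1 constant C one =
        let e , sum≡ = wsum-count≡1 C one
        in realisation e (sym (⊖≡origin⇒≡ _ _ (trans (sym sum≡) (classConstant⇒wsum-indep constant C []))))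

      classConstant⇒NAC : c Preserves AP G ⟶ _≡_ → (∃ λ e → c e ≡ true) → (∃ λ e → c e ≡ false) → IsNAC G c
      classConstant⇒NAC {c} constant some-true some-false = some-true , some-false , λ v C _ →
        NACCount-complement (count-complement c (edges G C))
          (classConstant⇒count≢1 constant C) (classConstant⇒count≢1 (λ e~e′ → cong not (constant e~e′)) C)

    module _ (p-injective : ∀ u v → p u ≡ p v → u ≡ v) (δ : Colouring G)
             (constant : col δ Preserves AP G ⟶ _≡_) where

      classConstant⇒cartesian : IsCartesian G δ
      classConstant⇒cartesian (v , w , v≢w , Prb , Prg , Pbg , _ , _ , _ , Prb-col , Prg-col , Pbg-col) =
        v≢w (sym (p-injective w v (⊖≡origin⇒≡ _ _ (begin
          p w ⊖ p v                                           ≡⟨ wsum-all Prb ⟨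
          wsum p (λ _ → true) Prb                             ≡⟨ wsum-split (λ _ → true) isRed Prb ⟩
          wsum p isRed Prb ⊕ wsum p (λ e → not (isRed e)) Prb ≡⟨ cong₂ _⊕_ red-part non-red-part ⟩
          origin ⊕ origin                                     ≡⟨ ⊕-identityˡ origin ⟩
          origin                                              ∎))))
        where
        isRed isBlue : Edge G → Bool
        isRed e  = isCol G red (col δ e)
        isBlue e = isCol G blue (col δ e)

        ¬red : ∀ {x} → x ≡ blue ⊎ x ≡ gold → ¬ T (isCol G red x)
        ¬red (inj₁ refl) ()
        ¬red (inj₂ refl) ()

        ¬blue : ∀ {x} → x ≡ red ⊎ x ≡ gold → ¬ T (isCol G blue x)
        ¬blue (inj₁ refl) ()
        ¬blue (inj₂ refl) ()

        non-red≡blue : ∀ {x} → x ≡ red ⊎ x ≡ blue → not (isCol G red x) ≡ isCol G blue x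
        non-red≡blue (inj₁ refl) = refl
        non-red≡blue (inj₂ refl) = refl

        isCol-constant : ∀ c → (λ e → isCol G c (col δ e)) Preserves AP G ⟶ _≡_
        isCol-constant c e~e′ = cong (isCol G c) (constant e~e′)

        red-part : wsum p isRed Prb ≡ origin
        red-part = begin
          wsum p isRed Prb  ≡⟨ classConstant⇒wsum-indep (isCol-constant red) Prb Pbg ⟩
          wsum p isRed Pbg  ≡⟨ wsum-none Pbg (All.map ¬red Pbg-col) ⟩
          origin            ∎

        non-red-part : wsum p (λ e → not (isRed e)) Prb ≡ origin
        non-red-part = begin
          wsum p (λ e → not (isRed e)) Prb  ≡⟨ wsum-cong Prb (All.map non-red≡blue Prb-col) ⟩
          wsum p isBlue Prb                 ≡⟨ classConstant⇒wsum-indep (isCol-constant blue) Prb Prg ⟩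
          wsum p isBlue Prg                 ≡⟨ wsum-none Prg (All.map ¬blue Prg-col) ⟩
          origin                            ∎

classConstant⇒cartesianRS : (F : RealField) {G : Graph} (p : V G → Plane.Pt F) →
  Framework.Realisation F G p → Framework.WalkIndependent F G p → (s : Reflection G) (δ : Colouring G) →
  RedBlueOccur G δ → col δ Preserves AP G ⟶ _≡_ → SwapsRedBlue s δ → IsCartesianRS G s δ
classConstant⇒cartesianRS F {G} p realisation (p-injective , _ , class-independent) s δ
                          ((r , r-red) , (b , b-blue)) constant swaps =
  ((pseudoRS , λ v C _ one → ⊥-elim (classConstant⇒count≢1 class-independent realisation gold-constant C one)) ,
   classConstant⇒cartesian class-independent p-injective δ constant)
  where
  open WalkSums F p

  nac : (f : Colour → Bool) → f red ≡ true → f blue ≡ false → IsNAC G (λ e → f (col δ e))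
  nac f f-red f-blue = classConstant⇒NAC class-independent realisation (λ e~e′ → cong f (constant e~e′))
    (r , trans (cong f r-red) f-red) (b , trans (cong f b-blue) f-blue)

  pseudoRS : PseudoRS G s δ
  pseudoRS = (r , r-red) , (b , b-blue) , nac (goldToBlue G) refl refl , nac (goldToRed G) refl refl ,
             swapsRedBlue⇒red⇔σblue s δ swaps

  gold-constant : (λ e → isCol G gold (col δ e)) Preserves AP G ⟶ _≡_
  gold-constant e~e′ = cong (isCol G gold) (constant e~e′)

lemma6p4 : (F : RealField) (G : Graph) → Connected G →
           (s : Reflection G) (p : V G → Plane.Pt F) →
           Framework.Realisation F G p →
           Framework.WalkIndependent F G p →
           Framework.ReflectionSymmetric F G s p →
           (δ : Colouring G) →
           IsCartesianRS G s δ ⇔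
             (RedBlueOccur G δ × FixedClassesGold G s δ × NonFixedClassesOK G s δ)
lemma6p4 F G _ s p realisation walk-independent _ δ = mk⇔
  (λ (((red-edge , blue-edge , nac-blue , nac-red , red⇔σblue) , _) , cartesian) →
    let constant = cartesian⇒classConstant δ nac-blue nac-red cartesian
        swaps    = red⇔σblue⇒swapsRedBlue s δ red⇔σblue
    in (red-edge , blue-edge) ,
       classConstant⇒fixedClassesGold s δ constant swaps , classConstant⇒nonFixedClassesOK s δ constant swaps)
  (λ (occur , fixedGold , nonFixedOK) →
    classConstant⇒cartesianRS F p realisation walk-independent s δ occur
      (conditions⇒classConstant s δ fixedGold nonFixedOK) (conditions⇒swapsRedBlue s δ fixedGold nonFixedOK))
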